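{- For all types $A,B$: if $S(A)\preceq B$, then there exists a type $C$ such that $B=S(C)$.
   Context: Types: base qubit types $B ::= \mathbb B \mid B\otimes B$; qubit types $\Psi ::= B \mid S(\Psi)\mid \Psi\otimes\Psi$; types $A ::= \Psi\mid \Psi\Rightarrow A\mid S(A)\mid A\otimes A$. Subtyping $\preceq$ is the reflexive-transitive relation generated by: $A\preceq S(A)$; $S(S(A))\preceq S(A)$; and if $A\preceq B$ then $\Psi\Rightarrow A\preceq\Psi\Rightarrow B$, $S(A)\preceq S(B)$, $A\otimes C\preceq B\otimes C$ and $C\otimes A\preceq C\otimes B$. -}

module Defs where

open import Relation.Binary.PropositionalEquality using (_≡_)

-- Raw type syntax (one grammar); the paper's layered grammars are carved out
-- by the predicates IsBase / IsQubit / IsType below.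
data Ty : Set where
  𝔹   : Ty
  _⊗_ : Ty → Ty → Ty
  S   : Ty → Ty
  _⇒_ : Ty → Ty → Ty

infixr 5 _⇒_
infixl 6 _⊗_

data IsBase : Ty → Set where
  base-𝔹 : IsBase 𝔹
  base-⊗ : ∀ {B B'} → IsBase B → IsBase B' → IsBase (B ⊗ B')

data IsQubit : Ty → Set where
  qb-base : ∀ {B} → IsBase B → IsQubit B
  qb-S    : ∀ {Ψ} → IsQubit Ψ → IsQubit (S Ψ)
  qb-⊗    : ∀ {Ψ Φ} → IsQubit Ψ → IsQubit Φ → IsQubit (Ψ ⊗ Φ)

data IsType : Ty → Set where
  ty-qb : ∀ {Ψ} → IsQubit Ψ → IsType Ψ
  ty-⇒  : ∀ {Ψ A} → IsQubit Ψ → IsType A → IsType (Ψ ⇒ A)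
  ty-S  : ∀ {A} → IsType A → IsType (S A)
  ty-⊗  : ∀ {A A'} → IsType A → IsType A' → IsType (A ⊗ A')

data _≼_ : Ty → Ty → Set where
  ≼-refl  : ∀ {A} → A ≼ A
  ≼-trans : ∀ {A B C} → A ≼ B → B ≼ C → A ≼ C
  ≼-S     : ∀ {A} → A ≼ S A
  ≼-SS    : ∀ {A} → S (S A) ≼ S A
  ≼-⇒     : ∀ {Ψ A B} → IsQubit Ψ → A ≼ B → (Ψ ⇒ A) ≼ (Ψ ⇒ B)
  ≼-Scong : ∀ {A B} → A ≼ B → S A ≼ S B
  ≼-⊗ˡ    : ∀ {A B C} → A ≼ B → (A ⊗ C) ≼ (B ⊗ C)
  ≼-⊗ʳ    : ∀ {A B C} → A ≼ B → (C ⊗ A) ≼ (C ⊗ B)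

infix 4 _≼_

module Submission where

-- Idea: call a raw type "superposed" when its head constructor is S.  Every
-- generating rule of ≼ whose left-hand side is superposed has a superposed
-- right-hand side (rules with an ⇒ or ⊗ head on the left never apply), and
-- the property is trivially preserved by reflexivity and transitivity; hence
-- superposed types are upward closed under ≼ (`superposed-upward-closed`).
-- Applied to S(A) ≼ B this gives B = S(C) for some C.  It remains to see
-- that C is a well-formed type, which follows because the grammar only
-- produces S(C) from a well-formed C (`IsType-S-inv`).

open import Defs
open import Data.Product using (Σ; _×_; _,_)
open import Relation.Binary.PropositionalEquality using (_≡_; refl)

data Superposed : Ty → Set where
  superposed : ∀ C → Superposed (S C)

superposed-upward-closed : ∀ {X Y} → X ≼ Y → Superposed X → Superposed Y
superposed-upward-closed ≼-refl           s = s
superposed-upward-closed (≼-trans X≼Z Z≼Y) s =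
  superposed-upward-closed Z≼Y (superposed-upward-closed X≼Z s)
superposed-upward-closed (≼-S {A})        _ = superposed A
superposed-upward-closed (≼-SS {A})       _ = superposed A
superposed-upward-closed (≼-Scong {B = B} _) _ = superposed B
superposed-upward-closed (≼-⇒ _ _)        ()
superposed-upward-closed (≼-⊗ˡ _)         ()
superposed-upward-closed (≼-⊗ʳ _)         ()

IsType-S-inv : ∀ {C} → IsType (S C) → IsType C
IsType-S-inv (ty-qb (qb-base ()))
IsType-S-inv (ty-qb (qb-S Ψ)) = ty-qb Ψ
IsType-S-inv (ty-S A)         = A

lemma5 : (A B : Ty) → IsType A → IsType B → S A ≼ B →
    Σ Ty (λ C → IsType C × (B ≡ S C))
lemma5 A B _ B-type SA≼B with superposed-upward-closed SA≼B (superposed A)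
... | superposed C = C , IsType-S-inv B-type , refl
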